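{- Let $\mathcal{A}$ be a central arrangement in $\mathbb{K}^3$ and suppose there are two distinct elements $p_1,p_2\in L(\mathcal{A})_2$ such that $\mu(p_1)+\mu(p_2)=|\mathcal{A}|-2$ and no plane of $\mathcal{A}$ contains both $p_1$ and $p_2$. Then $t_{\mathcal{A}}=2$.
   Context: $\mathbb{K}$ is a field of characteristic zero. A central arrangement in $\mathbb{K}^3$ is a finite set of planes through the origin. $L(\mathcal{A})$ is the set of all intersections of subsets of $\mathcal{A}$ (including $\mathbb{K}^3$) ordered by reverse inclusion, $L(\mathcal{A})_2$ its elements of codimension 2 (lines), and $\mu$ the Möbius function: $\mu(\mathbb{K}^3)=1$, $\mu(X)=-\sum_{Y<X}\mu(Y)$. For a hyperplane $H$, $(\mathcal{A}\cup\{H\})^H=\{H'\cap H\mid H'\in\mathcal{A}, H'\neq H\}$ (distinct subspaces). The minimal restriction number is $t_{\mathcal{A}}=\min\{|(\mathcal{A}\cup\{H\})^H| : H \text{ a plane through the origin in }\mathbb{K}^3,\ H\notin\mathcal{A}\}$. -}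

module Defs where

open import Level using (Level; _⊔_)
open import Algebra.Bundles using (CommutativeRing)
open import Data.Nat using (ℕ; zero; suc)
open import Data.Integer as ℤ using (ℤ)
open import Data.Fin using (Fin)
open import Data.Bool using (Bool; true; false; if_then_else_)
open import Data.Product using (Σ; ∃; _×_; _,_)
open import Relation.Nullary using (¬_)
open import Relation.Binary.PropositionalEquality using (_≡_)

record IsField {c ℓ : Level} (R : CommutativeRing c ℓ) : Set (c ⊔ ℓ) where
  open CommutativeRing R
  field
    1≉0     : ¬ (1# ≈ 0#)
    inverse : ∀ x → ¬ (x ≈ 0#) → ∃ λ y → (x * y) ≈ 1#

module _ {c ℓ : Level} (R : CommutativeRing c ℓ) where
  open CommutativeRing R

  fromℕ : ℕ → Carrier
  fromℕ zero    = 0#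
  fromℕ (suc n) = 1# + fromℕ n

  CharZero : Set ℓ
  CharZero = ∀ n → ¬ (fromℕ (suc n) ≈ 0#)

  V : Set c
  V = Carrier × Carrier × Carrier

  NonZero : V → Set ℓ
  NonZero (a , b , d) = ¬ ((a ≈ 0#) × (b ≈ 0#) × (d ≈ 0#))

  dot : V → V → Carrier
  dot (a₁ , a₂ , a₃) (x₁ , x₂ , x₃) = (a₁ * x₁) + ((a₂ * x₂) + (a₃ * x₃))

  scale : Carrier → V → V
  scale t (x₁ , x₂ , x₃) = (t * x₁ , t * x₂ , t * x₃)

  _≈V_ : V → V → Set ℓ
  (x₁ , x₂ , x₃) ≈V (y₁ , y₂ , y₃) = (x₁ ≈ y₁) × (x₂ ≈ y₂) × (x₃ ≈ y₃)

  Sub : Set (Level.suc (c ⊔ ℓ))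
  Sub = V → Set (c ⊔ ℓ)

  _≐_ : Sub → Sub → Set (c ⊔ ℓ)
  X ≐ Y = ∀ x → (X x → Y x) × (Y x → X x)

  _⊆_ : Sub → Sub → Set (c ⊔ ℓ)
  X ⊆ Y = ∀ x → X x → Y x

  _∩_ : Sub → Sub → Sub
  (X ∩ Y) x = X x × Y x

  plane : V → Sub
  plane a x = Level.Lift c (dot a x ≈ 0#)

  span : V → Sub
  span v x = ∃ λ t → scale t v ≈V x

  IsLine : Sub → Set (c ⊔ ℓ)
  IsLine X = ∃ λ v → NonZero v × (X ≐ span v)

  record Arrangement : Set (c ⊔ ℓ) where
    field
      size     : ℕ
      normal   : Fin size → V
      nonzero  : ∀ i → NonZero (normal i)
      distinct : ∀ i j → plane (normal i) ≐ plane (normal j) → i ≡ j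

  module _ (A : Arrangement) where
    open Arrangement A

    hyp : Fin size → Sub
    hyp i = plane (normal i)

    -- intersection of the subset S of A (the empty subset gives K³)
    ⋂ : (Fin size → Bool) → Sub
    ⋂ S x = ∀ i → S i ≡ true → hyp i x

    InL : Sub → Set (c ⊔ ℓ)
    InL X = ∃ λ (S : Fin size → Bool) → X ≐ ⋂ S

    InL₂ : Sub → Set (c ⊔ ℓ)
    InL₂ X = InL X × IsLine X

    sumFin : ∀ {n} → (Fin n → ℤ) → ℤ
    sumFin {zero}  f = ℤ.0ℤ
    sumFin {suc n} f = f Fin.zero ℤ.+ sumFin (λ i → f (Fin.suc i))

    μ-top : ℤ
    μ-top = ℤ.1ℤ

    μ-plane : ℤ
    μ-plane = ℤ.- μ-top

    -- For a line X ∈ L(A)₂, the elements Y < X of L(A) are K³ and the planes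
    -- of A containing X, so μ(X) = -(μ(K³) + Σ_{H ∈ A, X ⊆ H} μ(H)).
    -- μ X z means: μ(X) = z.  (S is the set of planes of A containing X.)
    μ : Sub → ℤ → Set (c ⊔ ℓ)
    μ X z = ∃ λ (S : Fin size → Bool) →
              (∀ i → (S i ≡ true → X ⊆ hyp i) × (X ⊆ hyp i → S i ≡ true)) ×
              (z ≡ ℤ.- (μ-top ℤ.+ sumFin (λ i → if S i then μ-plane else ℤ.0ℤ)))

    NotInA : V → Set (c ⊔ ℓ)
    NotInA b = ∀ i → ¬ (hyp i ≐ plane b)

    -- (A ∪ {H})^H for H = plane b ∉ A, as a set of subspaces
    Restr : V → Sub → Set (c ⊔ ℓ)
    Restr b X = ∃ λ i → X ≐ (hyp i ∩ plane b)

  HasCard : (Sub → Set (c ⊔ ℓ)) → ℕ → Set (Level.suc (c ⊔ ℓ))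
  HasCard 𝒮 k = Σ (Fin k → Sub) λ f →
      (∀ j → 𝒮 (f j)) ×
      (∀ X → 𝒮 X → ∃ λ j → X ≐ f j) ×
      (∀ j j' → f j ≐ f j' → j ≡ j')

  -- t_A = m : the minimum of |(A ∪ {H})^H| over planes H ∉ A equals m
  MinRestrictionNumber : Arrangement → ℕ → Set (Level.suc (c ⊔ ℓ))
  MinRestrictionNumber A m =
    (∃ λ b → NonZero b × NotInA A b × HasCard (Restr A b) m) ×
    (∀ b → NonZero b → NotInA A b → ∀ k → HasCard (Restr A b) k → m Data.Nat.≤ k)

-- μ of a line of L(A) is one less than the number of planes of A through it, so the
-- hypothesis on μ(p₁) + μ(p₂), together with the absence of a common plane, says that every
-- plane of A contains exactly one of p₁ = span v₁ and p₂ = span v₂. The plane H with normal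
-- v₁ × v₂ contains both lines, so it is not in A and meets every plane of A in p₁ or p₂.
-- Conversely, if a plane H′ had at most one restriction, all H_i ∩ H′ would coincide; that
-- common set lies in every plane of A, hence in p₁ and in a plane not containing p₁, so it
-- is 0. But the planes with normals n and b share the vector n × b, so the normal b of H′
-- would be parallel to two independent normals of A, hence zero.

module Submission where

open import Defs
open import Level using (Level; _⊔_; lift; lower)
open import Algebra.Bundles using (CommutativeRing)
open import Data.Product using (∃; _×_; _,_; proj₁; proj₂)
open import Relation.Nullary using (¬_; yes; no)
open import Relation.Binary.PropositionalEquality as ≡ using (_≡_)
open import Algebra.Solver.Ring.AlmostCommutativeRing using (fromCommutativeRing; _-Raw-AlmostCommutative⟶_)
open import Data.Bool as Bool using (Bool; true; false; if_then_else_; _∨_)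
open import Data.Empty using (⊥; ⊥-elim)
open import Data.Fin using (Fin; zero; suc)
open import Data.Fin.Properties using (any?)
open import Data.Integer as ℤ using (ℤ; +_; -[1+_]; _◃_; 0ℤ; 1ℤ)
import Data.Integer.Properties as ℤ
open import Data.Integer.Tactic.RingSolver using (solve-∀)
open import Data.Nat as ℕ using (ℕ; zero; suc)
import Data.Nat.Properties as ℕ
import Data.Maybe as Maybe
import Data.Sign as Sign
open import Data.Sum as Sum using (_⊎_; inj₁; inj₂)
open import Function using (_∘_)
open import Relation.Binary.Consequences using (dec⇒weaklyDec)

-- The ring solver for K with coefficients in ℤ, where equality is decidable, so that
-- cancellations such as x - x ≈ 0 are detected.
module IntegerCoefficients {c ℓ : Level} (K : CommutativeRing c ℓ) where
  open CommutativeRing K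
  open import Algebra.Properties.Semiring.Mult.TCOptimised semiring using (1+×; ×-homo-+; ×1-homo-*) renaming (_×_ to _×′_)
  open import Algebra.Properties.Ring ring using (-1*x≈-x; -0#≈0#; -‿involutive)
  open import Algebra.Properties.CommutativeSemigroup *-commutativeSemigroup using () renaming (interchange to *-interchange)
  open import Algebra.Properties.AbelianGroup +-abelianGroup using (⁻¹-∙-comm)
  open import Relation.Binary.Reasoning.Setoid setoid

  -- The optimised multiple makes fromℤ (+ 1) definitionally 1#, so the solver can prove
  -- identities involving the unit vectors by refl.
  fromℤ : ℤ → Carrier
  fromℤ (+ n) = n ×′ 1#
  fromℤ (-[1+ n ]) = - (suc n ×′ 1#)

  [u+x]-[u+y]≈x-y : ∀ u x y → (u + x) - (u + y) ≈ x - y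
  [u+x]-[u+y]≈x-y u x y = begin
    (u + x) - (u + y)     ≈⟨ +-congˡ (sym (⁻¹-∙-comm u y)) ⟩
    (u + x) + (- u + - y) ≈⟨ +-assoc u x (- u + - y) ⟩
    u + (x + (- u + - y)) ≈⟨ +-congˡ (+-congˡ (+-comm (- u) (- y))) ⟩
    u + (x + (- y + - u)) ≈⟨ +-congˡ (sym (+-assoc x (- y) (- u))) ⟩
    u + ((x - y) + - u)   ≈⟨ +-congˡ (+-comm (x - y) (- u)) ⟩
    u + (- u + (x - y))   ≈⟨ sym (+-assoc u (- u) (x - y)) ⟩
    (u - u) + (x - y)     ≈⟨ +-congʳ (-‿inverseʳ u) ⟩
    0# + (x - y)          ≈⟨ +-identityˡ (x - y) ⟩
    x - y                 ∎

  ⊖-homo : ∀ m n → fromℤ (m ℤ.⊖ n) ≈ m ×′ 1# - n ×′ 1#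
  ⊖-homo m zero = sym (trans (+-congˡ -0#≈0#) (+-identityʳ _))
  ⊖-homo zero (suc n) = sym (+-identityˡ _)
  ⊖-homo (suc m) (suc n) = begin
    fromℤ (suc m ℤ.⊖ suc n)           ≡⟨ ≡.cong fromℤ (ℤ.[1+m]⊖[1+n]≡m⊖n m n) ⟩
    fromℤ (m ℤ.⊖ n)                   ≈⟨ ⊖-homo m n ⟩
    m ×′ 1# - n ×′ 1#               ≈⟨ [u+x]-[u+y]≈x-y 1# (m ×′ 1#) (n ×′ 1#) ⟨
    (1# + m ×′ 1#) - (1# + n ×′ 1#) ≈⟨ +-cong (1+× m 1#) (-‿cong (1+× n 1#)) ⟨
    suc m ×′ 1# - suc n ×′ 1#       ∎

  +-homo : ∀ i j → fromℤ (i ℤ.+ j) ≈ fromℤ i + fromℤ j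
  +-homo (+ m) (+ n) = ×-homo-+ 1# m n
  +-homo (+ m) -[1+ n ] = ⊖-homo m (suc n)
  +-homo -[1+ m ] (+ n) = trans (⊖-homo n (suc m)) (+-comm _ _)
  +-homo -[1+ m ] -[1+ n ] = begin
    - (suc (suc (m ℕ.+ n)) ×′ 1#)       ≡⟨ ≡.cong (λ k → - (suc k ×′ 1#)) (ℕ.+-suc m n) ⟨
    - ((suc m ℕ.+ suc n) ×′ 1#)         ≈⟨ -‿cong (×-homo-+ 1# (suc m) (suc n)) ⟩
    - (suc m ×′ 1# + suc n ×′ 1#)        ≈⟨ ⁻¹-∙-comm _ _ ⟨
    - (suc m ×′ 1#) + - (suc n ×′ 1#)    ∎

  -‿homo : ∀ i → fromℤ (ℤ.- i) ≈ - fromℤ i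
  -‿homo (+ zero) = sym -0#≈0#
  -‿homo (+ suc n) = refl
  -‿homo -[1+ n ] = sym (-‿involutive _)

  ◃-homo : ∀ (s : Sign.Sign) n → fromℤ (s ℤ.◃ n) ≈ fromℤ (s ℤ.◃ 1) * n ×′ 1#
  ◃-homo s zero = sym (zeroʳ _)
  ◃-homo Sign.+ (suc n) = sym (*-identityˡ _)
  ◃-homo Sign.- (suc n) = sym (-1*x≈-x _)

  sign-homo : ∀ s t → fromℤ (s Sign.* t ℤ.◃ 1) ≈ fromℤ (s ℤ.◃ 1) * fromℤ (t ℤ.◃ 1)
  sign-homo Sign.+ t = sym (*-identityˡ _)
  sign-homo Sign.- Sign.+ = sym (*-identityʳ _)
  sign-homo Sign.- Sign.- = begin
    1#            ≈⟨ -‿involutive 1# ⟨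
    - - 1#        ≈⟨ -1*x≈-x (- 1#) ⟨
    - 1# * - 1#   ∎

  *-homo : ∀ i j → fromℤ (i ℤ.* j) ≈ fromℤ i * fromℤ j
  *-homo i j = begin
    fromℤ (st ◃ ∣i∣ ℕ.* ∣j∣)                             ≈⟨ ◃-homo st (∣i∣ ℕ.* ∣j∣) ⟩
    fromℤ (st ◃ 1) * (∣i∣ ℕ.* ∣j∣) ×′ 1#                  ≈⟨ *-cong (sign-homo s t) (×1-homo-* ∣i∣ ∣j∣) ⟩
    (fromℤ (s ◃ 1) * fromℤ (t ◃ 1)) * (∣i∣ ×′ 1# * ∣j∣ ×′ 1#)     ≈⟨ *-interchange _ _ _ _ ⟩
    (fromℤ (s ◃ 1) * ∣i∣ ×′ 1#) * (fromℤ (t ◃ 1) * ∣j∣ ×′ 1#)     ≈⟨ *-cong (◃-homo s ∣i∣) (◃-homo t ∣j∣) ⟨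
    fromℤ (s ◃ ∣i∣) * fromℤ (t ◃ ∣j∣)                           ≡⟨ ≡.cong₂ (λ i j → fromℤ i * fromℤ j) (ℤ.◃-inverse i) (ℤ.◃-inverse j) ⟩
    fromℤ i * fromℤ j                                       ∎
    where
    s t st : Sign.Sign
    s = ℤ.sign i
    t = ℤ.sign j
    st = s Sign.* t
    ∣i∣ ∣j∣ : ℕ
    ∣i∣ = ℤ.∣ i ∣
    ∣j∣ = ℤ.∣ j ∣

  homomorphism : ℤ.+-*-rawRing -Raw-AlmostCommutative⟶ fromCommutativeRing K
  homomorphism = record
    { ⟦_⟧ = fromℤ ; +-homo = +-homo ; *-homo = *-homo ; -‿homo = -‿homo ; 0-homo = refl ; 1-homo = refl }

  ⟦⟧-weaklyDecidable : ∀ i j → Maybe.Maybe (fromℤ i ≈ fromℤ j)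
  ⟦⟧-weaklyDecidable i j = Maybe.map (reflexive ∘ ≡.cong fromℤ) (dec⇒weaklyDec ℤ._≟_ i j)

  open import Algebra.Solver.Ring ℤ.+-*-rawRing (fromCommutativeRing K) homomorphism ⟦⟧-weaklyDecidable public

-- Generic in the operations so that the same definitions serve K, where _·_ is
-- definitionally dot K, and the solver's polynomials.
module Vec3 {a} {A : Set a} (_+_ _*_ : A → A → A) (-_ : A → A) where
  infix 8 _·_
  infixr 9 _⨯_

  _·_ : A × A × A → A × A × A → A
  (a₁ , a₂ , a₃) · (x₁ , x₂ , x₃) = (a₁ * x₁) + ((a₂ * x₂) + (a₃ * x₃))

  private
    _-_ : A → A → A
    x - y = x + (- y)

  _⨯_ : A × A × A → A × A × A → A × A × A
  (a₁ , a₂ , a₃) ⨯ (b₁ , b₂ , b₃) = ((a₂ * b₃) - (a₃ * b₂)) , ((a₃ * b₁) - (a₁ * b₃)) , ((a₁ * b₂) - (a₂ * b₁))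

  det : A × A × A → A × A × A → A × A × A → A
  det a b d = (a ⨯ b) · d

module _ {c ℓ : Level} (K : CommutativeRing c ℓ) where
  open CommutativeRing K hiding (zero)
  open IntegerCoefficients K using (Polynomial; solve; _:=_; _:+_; _:*_; _:-_; :-_; con)
  open Vec3 _+_ _*_ -_ using (_·_; _⨯_; det)
  open import Algebra.Properties.Group +-group using (x∙y⁻¹≈ε⇒x≈y)
  open import Relation.Binary.Reasoning.Setoid setoid

  private
    module P {n : ℕ} = Vec3 {A = Polynomial n} _:+_ _:*_ :-_

  infix 4 _≋_
  _≋_ : V K → V K → Set ℓ
  _≋_ = _≈V_ K

  0ᵥ : V K
  0ᵥ = 0# , 0# , 0#

  ·-comm : ∀ a x → a · x ≈ x · a
  ·-comm (a₁ , a₂ , a₃) (x₁ , x₂ , x₃) =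
    solve 6 (λ a₁ a₂ a₃ x₁ x₂ x₃ → (a₁ , a₂ , a₃) P.· (x₁ , x₂ , x₃) := (x₁ , x₂ , x₃) P.· (a₁ , a₂ , a₃))
      refl a₁ a₂ a₃ x₁ x₂ x₃

  ·-scaleʳ : ∀ a t x → a · scale K t x ≈ t * a · x
  ·-scaleʳ (a₁ , a₂ , a₃) t (x₁ , x₂ , x₃) =
    solve 7 (λ a₁ a₂ a₃ t x₁ x₂ x₃ →
        (a₁ , a₂ , a₃) P.· (t :* x₁ , t :* x₂ , t :* x₃) := t :* ((a₁ , a₂ , a₃) P.· (x₁ , x₂ , x₃)))
      refl a₁ a₂ a₃ t x₁ x₂ x₃

  ·-zeroˡ : ∀ x → 0ᵥ · x ≈ 0#
  ·-zeroˡ (x₁ , x₂ , x₃) =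
    solve 3 (λ x₁ x₂ x₃ → (con (+ 0) , con (+ 0) , con (+ 0)) P.· (x₁ , x₂ , x₃) := con (+ 0)) refl x₁ x₂ x₃

  ·-e₁ : ∀ x → x · (1# , 0# , 0#) ≈ proj₁ x
  ·-e₁ (x₁ , x₂ , x₃) =
    solve 3 (λ x₁ x₂ x₃ → (x₁ , x₂ , x₃) P.· (con (+ 1) , con (+ 0) , con (+ 0)) := x₁) refl x₁ x₂ x₃

  ·-e₂ : ∀ x → x · (0# , 1# , 0#) ≈ proj₁ (proj₂ x)
  ·-e₂ (x₁ , x₂ , x₃) =
    solve 3 (λ x₁ x₂ x₃ → (x₁ , x₂ , x₃) P.· (con (+ 0) , con (+ 1) , con (+ 0)) := x₂) refl x₁ x₂ x₃

  ·-e₃ : ∀ x → x · (0# , 0# , 1#) ≈ proj₂ (proj₂ x)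
  ·-e₃ (x₁ , x₂ , x₃) =
    solve 3 (λ x₁ x₂ x₃ → (x₁ , x₂ , x₃) P.· (con (+ 0) , con (+ 0) , con (+ 1)) := x₃) refl x₁ x₂ x₃

  det-repeat₁₃ : ∀ u w → det u w u ≈ 0#
  det-repeat₁₃ (u₁ , u₂ , u₃) (w₁ , w₂ , w₃) =
    solve 6 (λ u₁ u₂ u₃ w₁ w₂ w₃ → P.det (u₁ , u₂ , u₃) (w₁ , w₂ , w₃) (u₁ , u₂ , u₃) := con (+ 0))
      refl u₁ u₂ u₃ w₁ w₂ w₃

  det-repeat₂₃ : ∀ u w → det u w w ≈ 0#
  det-repeat₂₃ (u₁ , u₂ , u₃) (w₁ , w₂ , w₃) =
    solve 6 (λ u₁ u₂ u₃ w₁ w₂ w₃ → P.det (u₁ , u₂ , u₃) (w₁ , w₂ , w₃) (w₁ , w₂ , w₃) := con (+ 0))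
      refl u₁ u₂ u₃ w₁ w₂ w₃

  binet-cauchy : ∀ a b u w → (a ⨯ b) · (u ⨯ w) ≈ a · u * b · w - a · w * b · u
  binet-cauchy (a₁ , a₂ , a₃) (b₁ , b₂ , b₃) (u₁ , u₂ , u₃) (w₁ , w₂ , w₃) =
    solve 12 (λ a₁ a₂ a₃ b₁ b₂ b₃ u₁ u₂ u₃ w₁ w₂ w₃ →
        let a = (a₁ , a₂ , a₃) ; b = (b₁ , b₂ , b₃) ; u = (u₁ , u₂ , u₃) ; w = (w₁ , w₂ , w₃) in
        (a P.⨯ b) P.· (u P.⨯ w) := (a P.· u) :* (b P.· w) :- (a P.· w) :* (b P.· u))
      refl a₁ a₂ a₃ b₁ b₂ b₃ u₁ u₂ u₃ w₁ w₂ w₃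

  cramer : ∀ a b d x e →
    det a b d * x · e ≈ a · x * det b d e + (b · x * det d a e + d · x * det a b e)
  cramer (a₁ , a₂ , a₃) (b₁ , b₂ , b₃) (d₁ , d₂ , d₃) (x₁ , x₂ , x₃) (e₁ , e₂ , e₃) =
    solve 15 (λ a₁ a₂ a₃ b₁ b₂ b₃ d₁ d₂ d₃ x₁ x₂ x₃ e₁ e₂ e₃ →
        let a = (a₁ , a₂ , a₃) ; b = (b₁ , b₂ , b₃) ; d = (d₁ , d₂ , d₃) ; x = (x₁ , x₂ , x₃) ; e = (e₁ , e₂ , e₃) in
        P.det a b d :* (x P.· e) :=
          (a P.· x) :* P.det b d e :+ ((b P.· x) :* P.det d a e :+ (d P.· x) :* P.det a b e))
      refl a₁ a₂ a₃ b₁ b₂ b₃ d₁ d₂ d₃ x₁ x₂ x₃ e₁ e₂ e₃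

  ·-congˡ : ∀ {a b} x → a ≋ b → a · x ≈ b · x
  ·-congˡ x (e₁ , e₂ , e₃) = +-cong (*-congʳ e₁) (+-cong (*-congʳ e₂) (*-congʳ e₃))

  ·-congʳ : ∀ a {x y} → x ≋ y → a · x ≈ a · y
  ·-congʳ a (e₁ , e₂ , e₃) = +-cong (*-congˡ e₁) (+-cong (*-congˡ e₂) (*-congˡ e₃))

  ·-extensional : ∀ x y → (∀ e → x · e ≈ y · e) → x ≋ y
  ·-extensional x y x·≈y· = coordinate _ ·-e₁ , coordinate _ ·-e₂ , coordinate _ ·-e₃
    where
    coordinate : ∀ {π : V K → Carrier} e → (∀ z → z · e ≈ π z) → π x ≈ π y
    coordinate e z·e≈πz = trans (sym (z·e≈πz x)) (trans (x·≈y· e) (z·e≈πz y))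

  binet-cauchy-zero : ∀ a b u w → (a ⨯ b) · (u ⨯ w) ≈ 0# → a · u * b · w ≈ a · w * b · u
  binet-cauchy-zero a b u w ≈0 = x∙y⁻¹≈ε⇒x≈y _ _ (trans (sym (binet-cauchy a b u w)) ≈0)

  ≐-refl : ∀ {X} → _≐_ K X X
  ≐-refl x = (λ h → h) , (λ h → h)

  ≐-sym : ∀ {X Y} → _≐_ K X Y → _≐_ K Y X
  ≐-sym X≐Y x = proj₂ (X≐Y x) , proj₁ (X≐Y x)

  ≐-trans : ∀ {X Y Z} → _≐_ K X Y → _≐_ K Y Z → _≐_ K X Z
  ≐-trans X≐Y Y≐Z x = proj₁ (Y≐Z x) ∘ proj₁ (X≐Y x) , proj₂ (X≐Y x) ∘ proj₂ (Y≐Z x)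

  v∈span[v] : ∀ v → span K v v
  v∈span[v] (v₁ , v₂ , v₃) = 1# , *-identityˡ v₁ , *-identityˡ v₂ , *-identityˡ v₃

  span⊆plane : ∀ {a v} → a · v ≈ 0# → _⊆_ K (span K v) (plane K a)
  span⊆plane {a} {v} a·v≈0 x (t , tv≋x) = lift (begin
    a · x           ≈⟨ ·-congʳ a tv≋x ⟨
    a · scale K t v ≈⟨ ·-scaleʳ a t v ⟩
    t * a · v       ≈⟨ *-congˡ a·v≈0 ⟩
    t * 0#          ≈⟨ zeroʳ t ⟩
    0#              ∎)

  ⊆plane⇒·≈0 : ∀ {X a v} → _≐_ K X (span K v) → _⊆_ K X (plane K a) → a · v ≈ 0#
  ⊆plane⇒·≈0 {v = v} X≐span X⊆plane = lower (X⊆plane v (proj₂ (X≐span v) (v∈span[v] v)))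

  ·≈0⇒⊆plane : ∀ {X a v} → _≐_ K X (span K v) → a · v ≈ 0# → _⊆_ K X (plane K a)
  ·≈0⇒⊆plane X≐span a·v≈0 x = span⊆plane a·v≈0 x ∘ proj₁ (X≐span x)

  ⨯∈plane∩plane : ∀ a b → _∩_ K (plane K a) (plane K b) (a ⨯ b)
  ⨯∈plane∩plane a b =
    lift (trans (·-comm a (a ⨯ b)) (det-repeat₁₃ a b)) , lift (trans (·-comm b (a ⨯ b)) (det-repeat₂₃ a b))

  module _ {𝒮 : Sub K → Set (c ⊔ ℓ)} where

    HasCard-2 : ∀ {X Y} → ¬ _≐_ K X Y → 𝒮 X → 𝒮 Y → (∀ Z → 𝒮 Z → _≐_ K Z X ⊎ _≐_ K Z Y) → HasCard K 𝒮 2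
    HasCard-2 {X} {Y} X≉Y X∈𝒮 Y∈𝒮 X-or-Y = element , element∈𝒮 , onto , injective
      where
      element : Fin 2 → Sub K
      element zero = X
      element (suc _) = Y
      element∈𝒮 : ∀ j → 𝒮 (element j)
      element∈𝒮 zero = X∈𝒮
      element∈𝒮 (suc _) = Y∈𝒮
      onto : ∀ Z → 𝒮 Z → ∃ λ j → _≐_ K Z (element j)
      onto Z Z∈𝒮 with X-or-Y Z Z∈𝒮
      ... | inj₁ Z≐X = zero , Z≐X
      ... | inj₂ Z≐Y = suc zero , Z≐Y
      injective : ∀ j j′ → _≐_ K (element j) (element j′) → j ≡ j′
      injective zero zero _ = ≡.refl
      injective zero (suc zero) X≐Y = ⊥-elim (X≉Y X≐Y)
      injective (suc zero) zero Y≐X = ⊥-elim (X≉Y (≐-sym Y≐X))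
      injective (suc zero) (suc zero) _ = ≡.refl

    HasCard⇒2≤ : ∀ {k X} → HasCard K 𝒮 k → 𝒮 X → ¬ (∀ Y → 𝒮 Y → _≐_ K Y X) → 2 ℕ.≤ k
    HasCard⇒2≤ {zero} {X} (_ , _ , onto , _) X∈𝒮 _ with () ← proj₁ (onto X X∈𝒮)
    HasCard⇒2≤ {suc zero} {X} (element , _ , onto , _) X∈𝒮 not-all-≐ = ⊥-elim (not-all-≐ all-≐)
      where
      ≐element : ∀ {Y} → 𝒮 Y → _≐_ K Y (element zero)
      ≐element {Y} Y∈𝒮 with zero , Y≐ ← onto Y Y∈𝒮 = Y≐
      all-≐ : ∀ Y → 𝒮 Y → _≐_ K Y X
      all-≐ Y Y∈𝒮 = ≐-trans (≐element Y∈𝒮) (≐-sym (≐element X∈𝒮))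
    HasCard⇒2≤ {suc (suc _)} _ _ _ = ℕ.s≤s (ℕ.s≤s ℕ.z≤n)

  module _ (isField : IsField K) where
    open IsField isField

    *-cancelˡ-≉0 : ∀ {x y z} → ¬ x ≈ 0# → x * y ≈ x * z → y ≈ z
    *-cancelˡ-≉0 {x} {y} {z} x≉0 xy≈xz = begin
      y             ≈⟨ x⁻¹*[x*w]≈w y ⟨
      x⁻¹ * (x * y) ≈⟨ *-congˡ xy≈xz ⟩
      x⁻¹ * (x * z) ≈⟨ x⁻¹*[x*w]≈w z ⟩
      z             ∎
      where
      x⁻¹ : Carrier
      x⁻¹ = proj₁ (inverse x x≉0)
      x⁻¹*[x*w]≈w : ∀ w → x⁻¹ * (x * w) ≈ w
      x⁻¹*[x*w]≈w w = begin
        x⁻¹ * (x * w) ≈⟨ *-assoc x⁻¹ x w ⟨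
        x⁻¹ * x * w   ≈⟨ *-congʳ (trans (*-comm x⁻¹ x) (proj₂ (inverse x x≉0))) ⟩
        1# * w        ≈⟨ *-identityˡ w ⟩
        w             ∎

    x*y≈0⇒y≈0 : ∀ {x y} → ¬ x ≈ 0# → x * y ≈ 0# → y ≈ 0#
    x*y≈0⇒y≈0 {x} x≉0 xy≈0 = *-cancelˡ-≉0 x≉0 (trans xy≈0 (sym (zeroʳ x)))

    x≉0∧y≉0⇒x*y≉0 : ∀ {x y} → ¬ x ≈ 0# → ¬ y ≈ 0# → ¬ x * y ≈ 0#
    x≉0∧y≉0⇒x*y≉0 x≉0 y≉0 = y≉0 ∘ x*y≈0⇒y≈0 x≉0

    det≉0⇒·-injective : ∀ {a b d} x y → ¬ det a b d ≈ 0# →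
      a · x ≈ a · y → b · x ≈ b · y → d · x ≈ d · y → x ≋ y
    det≉0⇒·-injective {a} {b} {d} x y det≉0 a·x≈a·y b·x≈b·y d·x≈d·y =
      ·-extensional x y λ e → *-cancelˡ-≉0 det≉0 (begin
        det a b d * x · e                                         ≈⟨ cramer a b d x e ⟩
        a · x * det b d e + (b · x * det d a e + d · x * det a b e) ≈⟨ +-cong (*-congʳ a·x≈a·y)
                                                                       (+-cong (*-congʳ b·x≈b·y) (*-congʳ d·x≈d·y)) ⟩
        a · y * det b d e + (b · y * det d a e + d · y * det a b e) ≈⟨ cramer a b d y e ⟨
        det a b d * y · e                                         ∎)

    span∩plane≋0 : ∀ {a v x} → ¬ a · v ≈ 0# → span K v x → plane K a x → x ≋ 0ᵥ
    span∩plane≋0 {a} {v} {x} a·v≉0 (t , tv₁≈x₁ , tv₂≈x₂ , tv₃≈x₃) (lift a·x≈0) =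
      vanishes tv₁≈x₁ , vanishes tv₂≈x₂ , vanishes tv₃≈x₃
      where
      t≈0 : t ≈ 0#
      t≈0 = x*y≈0⇒y≈0 a·v≉0 (begin
        a · v * t       ≈⟨ *-comm (a · v) t ⟩
        t * a · v       ≈⟨ ·-scaleʳ a t v ⟨
        a · scale K t v ≈⟨ ·-congʳ a (tv₁≈x₁ , tv₂≈x₂ , tv₃≈x₃) ⟩
        a · x           ≈⟨ a·x≈0 ⟩
        0#              ∎)
      vanishes : ∀ {vᵢ xᵢ} → t * vᵢ ≈ xᵢ → xᵢ ≈ 0#
      vanishes {vᵢ} tvᵢ≈xᵢ = trans (sym tvᵢ≈xᵢ) (trans (*-congʳ t≈0) (zeroˡ vᵢ))

    plane∩plane≐span : ∀ {a b d v} → a · v ≈ 0# → d · v ≈ 0# → ¬ b · v ≈ 0# → ¬ det a b d ≈ 0# →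
      _≐_ K (_∩_ K (plane K a) (plane K d)) (span K v)
    plane∩plane≐span {a} {b} {d} {v} a·v≈0 d·v≈0 b·v≉0 det≉0 x = to , from
      where
      from : span K v x → _∩_ K (plane K a) (plane K d) x
      from x∈span = span⊆plane a·v≈0 x x∈span , span⊆plane d·v≈0 x x∈span
      [b·v]⁻¹ : Carrier
      [b·v]⁻¹ = proj₁ (inverse (b · v) b·v≉0)
      -- x and t v agree against b by the choice of t, and against a and d since both lie
      -- in plane a ∩ plane d; so Cramer's rule identifies them.
      t : Carrier
      t = [b·v]⁻¹ * b · x
      tv : V K
      tv = scale K t v
      b·tv≈b·x : b · tv ≈ b · x
      b·tv≈b·x = begin
        b · tv                    ≈⟨ ·-scaleʳ b t v ⟩
        t * b · v                 ≈⟨ *-comm t (b · v) ⟩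
        b · v * ([b·v]⁻¹ * b · x) ≈⟨ *-assoc (b · v) [b·v]⁻¹ (b · x) ⟨
        b · v * [b·v]⁻¹ * b · x   ≈⟨ *-congʳ (proj₂ (inverse (b · v) b·v≉0)) ⟩
        1# * b · x                ≈⟨ *-identityˡ (b · x) ⟩
        b · x                     ∎
      tv∈plane : ∀ {f} → f · v ≈ 0# → f · tv ≈ 0#
      tv∈plane f·v≈0 = lower (span⊆plane f·v≈0 tv (t , refl , refl , refl))
      to : _∩_ K (plane K a) (plane K d) x → span K v x
      to (lift a·x≈0 , lift d·x≈0) = t , det≉0⇒·-injective tv x det≉0
        (trans (tv∈plane a·v≈0) (sym a·x≈0)) b·tv≈b·x (trans (tv∈plane d·v≈0) (sym d·x≈0))

    span≢whole : ∀ v → ¬ (∀ x → span K v x)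
    span≢whole (v₁ , v₂ , v₃) everything
      with t , tv₁≈1 , tv₂≈0 , _ ← everything (1# , 0# , 0#)
         | s , sv₁≈0 , sv₂≈1 , _ ← everything (0# , 1# , 0#) = 1≉0 (begin
      1#                  ≈⟨ *-identityˡ 1# ⟨
      1# * 1#             ≈⟨ *-cong tv₁≈1 sv₂≈1 ⟨
      (t * v₁) * (s * v₂) ≈⟨ solve 4 (λ t v₁ s v₂ → (t :* v₁) :* (s :* v₂) := (t :* v₂) :* (s :* v₁)) refl t v₁ s v₂ ⟩
      (t * v₂) * (s * v₁) ≈⟨ *-cong tv₂≈0 sv₁≈0 ⟩
      0# * 0#             ≈⟨ zeroˡ 0# ⟩
      0#                  ∎)

    det-⨯≉0ˡ : ∀ {a b u w} → a · u ≈ 0# → ¬ a · w ≈ 0# → ¬ b · u ≈ 0# → ¬ det a b (u ⨯ w) ≈ 0#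
    det-⨯≉0ˡ {a} {b} {u} {w} a·u≈0 a·w≉0 b·u≉0 det≈0 = x≉0∧y≉0⇒x*y≉0 a·w≉0 b·u≉0 (begin
      a · w * b · u ≈⟨ binet-cauchy-zero a b u w det≈0 ⟨
      a · u * b · w ≈⟨ *-congʳ a·u≈0 ⟩
      0# * b · w    ≈⟨ zeroˡ (b · w) ⟩
      0#            ∎)

    det-⨯≉0ʳ : ∀ {a b u w} → a · w ≈ 0# → ¬ a · u ≈ 0# → ¬ b · w ≈ 0# → ¬ det a b (u ⨯ w) ≈ 0#
    det-⨯≉0ʳ {a} {b} {u} {w} a·w≈0 a·u≉0 b·w≉0 det≈0 = x≉0∧y≉0⇒x*y≉0 a·u≉0 b·w≉0 (begin
      a · u * b · w ≈⟨ binet-cauchy-zero a b u w det≈0 ⟩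
      a · w * b · u ≈⟨ *-congʳ a·w≈0 ⟩
      0# * b · u    ≈⟨ zeroˡ (b · u) ⟩
      0#            ∎)

    ⨯≋0-both⇒≋0 : ∀ {a d b u w} → a ⨯ b ≋ 0ᵥ → d ⨯ b ≋ 0ᵥ →
      a · u ≈ 0# → ¬ a · w ≈ 0# → ¬ d · u ≈ 0# → b ≋ 0ᵥ
    ⨯≋0-both⇒≋0 {a} {d} {b} {u} {w} a⨯b≋0 d⨯b≋0 a·u≈0 a·w≉0 d·u≉0 =
      ·-extensional b 0ᵥ λ e → trans (b·e≈0 e) (sym (·-zeroˡ e))
      where
      parallel : ∀ {f} → f ⨯ b ≋ 0ᵥ → ∀ x y → f · x * b · y ≈ f · y * b · x
      parallel {f} f⨯b≋0 x y = binet-cauchy-zero f b x y (trans (·-congˡ (x ⨯ y) f⨯b≋0) (·-zeroˡ (x ⨯ y)))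
      b·u≈0 : b · u ≈ 0#
      b·u≈0 = x*y≈0⇒y≈0 a·w≉0 (begin
        a · w * b · u ≈⟨ parallel a⨯b≋0 w u ⟩
        a · u * b · w ≈⟨ *-congʳ a·u≈0 ⟩
        0# * b · w    ≈⟨ zeroˡ (b · w) ⟩
        0#            ∎)
      b·e≈0 : ∀ e → b · e ≈ 0#
      b·e≈0 e = x*y≈0⇒y≈0 d·u≉0 (begin
        d · u * b · e ≈⟨ parallel d⨯b≋0 u e ⟩
        d · e * b · u ≈⟨ *-congˡ b·u≈0 ⟩
        d · e * 0#    ≈⟨ zeroʳ (d · e) ⟩
        0#            ∎)

    module _ (A : Arrangement K) where
      open Arrangement A

      InL₂⇒⊆hyp : ∀ {X} → InL₂ K A X → ∃ λ i → _⊆_ K X (hyp K A i)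
      -- If T selects no plane then ⋂ T is all of K³, which is not a line.
      InL₂⇒⊆hyp ((T , X≐⋂T) , v , _ , X≐span) with any? (λ i → T i Bool.≟ true)
      ... | yes (i , Tᵢ) = i , λ x x∈X → proj₁ (X≐⋂T x) x∈X i Tᵢ
      ... | no ¬∃T = ⊥-elim (span≢whole v λ x →
              proj₁ (X≐span x) (proj₂ (X≐⋂T x) λ i Tᵢ → ⊥-elim (¬∃T (i , Tᵢ))))

      module _ {p₁ p₂ : Sub K} (p₁∈L₂ : InL₂ K A p₁) (p₂∈L₂ : InL₂ K A p₂) (p₁≉p₂ : ¬ _≐_ K p₁ p₂)
        (no-common-plane : ¬ (∃ λ i → _⊆_ K p₁ (hyp K A i) × _⊆_ K p₂ (hyp K A i)))
        (p₁-or-p₂ : ∀ i → _⊆_ K p₁ (hyp K A i) ⊎ _⊆_ K p₂ (hyp K A i)) where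

        private
          v₁ v₂ : V K
          v₁ = proj₁ (proj₂ p₁∈L₂)
          v₂ = proj₁ (proj₂ p₂∈L₂)

          p₁≐span : _≐_ K p₁ (span K v₁)
          p₁≐span = proj₂ (proj₂ (proj₂ p₁∈L₂))

          p₂≐span : _≐_ K p₂ (span K v₂)
          p₂≐span = proj₂ (proj₂ (proj₂ p₂∈L₂))

          i₁ i₂ : Fin size
          i₁ = proj₁ (InL₂⇒⊆hyp p₁∈L₂)
          i₂ = proj₁ (InL₂⇒⊆hyp p₂∈L₂)

          p₁⊆hyp₁ : _⊆_ K p₁ (hyp K A i₁)
          p₁⊆hyp₁ = proj₂ (InL₂⇒⊆hyp p₁∈L₂)

          p₂⊆hyp₂ : _⊆_ K p₂ (hyp K A i₂)
          p₂⊆hyp₂ = proj₂ (InL₂⇒⊆hyp p₂∈L₂)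

          h : V K
          h = v₁ ⨯ v₂

        p₁⊆⇒·v₁≈0 : ∀ {i} → _⊆_ K p₁ (hyp K A i) → normal i · v₁ ≈ 0#
        p₁⊆⇒·v₁≈0 = ⊆plane⇒·≈0 p₁≐span

        p₂⊆⇒·v₂≈0 : ∀ {i} → _⊆_ K p₂ (hyp K A i) → normal i · v₂ ≈ 0#
        p₂⊆⇒·v₂≈0 = ⊆plane⇒·≈0 p₂≐span

        p₂⊆⇒·v₁≉0 : ∀ {i} → _⊆_ K p₂ (hyp K A i) → ¬ normal i · v₁ ≈ 0#
        p₂⊆⇒·v₁≉0 p₂⊆hyp n·v₁≈0 = no-common-plane (_ , ·≈0⇒⊆plane p₁≐span n·v₁≈0 , p₂⊆hyp)

        p₁⊆⇒·v₂≉0 : ∀ {i} → _⊆_ K p₁ (hyp K A i) → ¬ normal i · v₂ ≈ 0#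
        p₁⊆⇒·v₂≉0 p₁⊆hyp n·v₂≈0 = no-common-plane (_ , p₁⊆hyp , ·≈0⇒⊆plane p₂≐span n·v₂≈0)

        hyp∩h≐p₁ : ∀ {i} → _⊆_ K p₁ (hyp K A i) → _≐_ K (_∩_ K (hyp K A i) (plane K h)) p₁
        hyp∩h≐p₁ p₁⊆hyp = ≐-trans
          (plane∩plane≐span (p₁⊆⇒·v₁≈0 p₁⊆hyp) (det-repeat₁₃ v₁ v₂) (p₂⊆⇒·v₁≉0 p₂⊆hyp₂)
            (det-⨯≉0ˡ (p₁⊆⇒·v₁≈0 p₁⊆hyp) (p₁⊆⇒·v₂≉0 p₁⊆hyp) (p₂⊆⇒·v₁≉0 p₂⊆hyp₂)))
          (≐-sym p₁≐span)

        hyp∩h≐p₂ : ∀ {i} → _⊆_ K p₂ (hyp K A i) → _≐_ K (_∩_ K (hyp K A i) (plane K h)) p₂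
        hyp∩h≐p₂ p₂⊆hyp = ≐-trans
          (plane∩plane≐span (p₂⊆⇒·v₂≈0 p₂⊆hyp) (det-repeat₂₃ v₁ v₂) (p₁⊆⇒·v₂≉0 p₁⊆hyp₁)
            (det-⨯≉0ʳ (p₂⊆⇒·v₂≈0 p₂⊆hyp) (p₂⊆⇒·v₁≉0 p₂⊆hyp) (p₁⊆⇒·v₂≉0 p₁⊆hyp₁)))
          (≐-sym p₂≐span)

        h≉0 : NonZero K h
        h≉0 h≋0 = det-⨯≉0ˡ (p₁⊆⇒·v₁≈0 p₁⊆hyp₁) (p₁⊆⇒·v₂≉0 p₁⊆hyp₁) (p₂⊆⇒·v₁≉0 p₂⊆hyp₂)
          (trans (·-congʳ (normal i₁ ⨯ normal i₂) h≋0) (trans (·-comm _ 0ᵥ) (·-zeroˡ _)))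

        h∉A : NotInA K A h
        h∉A i hyp≐h = no-common-plane (i , ⊆hyp p₁≐span (det-repeat₁₃ v₁ v₂) , ⊆hyp p₂≐span (det-repeat₂₃ v₁ v₂))
          where
          ⊆hyp : ∀ {X v} → _≐_ K X (span K v) → h · v ≈ 0# → _⊆_ K X (hyp K A i)
          ⊆hyp X≐span h·v≈0 x = proj₂ (hyp≐h x) ∘ ·≈0⇒⊆plane X≐span h·v≈0 x

        restriction-to-h : HasCard K (Restr K A h) 2
        restriction-to-h = HasCard-2 p₁≉p₂ (i₁ , ≐-sym (hyp∩h≐p₁ p₁⊆hyp₁)) (i₂ , ≐-sym (hyp∩h≐p₂ p₂⊆hyp₂))
          λ { Z (i , Z≐) → Sum.map (≐-trans Z≐ ∘ hyp∩h≐p₁) (≐-trans Z≐ ∘ hyp∩h≐p₂) (p₁-or-p₂ i) }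

        restrictions-differ : ∀ {b} → NonZero K b →
          ¬ (∀ Y → Restr K A b Y → _≐_ K Y (_∩_ K (hyp K A i₁) (plane K b)))
        restrictions-differ {b} b≉0 all≐ = b≉0 (⨯≋0-both⇒≋0
          (X≋0 (normal i₁ ⨯ b) (⨯∈plane∩plane (normal i₁) b))
          (X≋0 (normal i₂ ⨯ b) (proj₁ (all≐ _ (i₂ , ≐-refl) (normal i₂ ⨯ b)) (⨯∈plane∩plane (normal i₂) b)))
          (p₁⊆⇒·v₁≈0 p₁⊆hyp₁) (p₁⊆⇒·v₂≉0 p₁⊆hyp₁) (p₂⊆⇒·v₁≉0 p₂⊆hyp₂))
          where
          X≋0 : ∀ x → _∩_ K (hyp K A i₁) (plane K b) x → x ≋ 0ᵥ
          X≋0 x x∈X = span∩plane≋0 (p₂⊆⇒·v₁≉0 p₂⊆hyp₂) (proj₁ (p₁≐span x) (proj₂ (p₁≐⋂ x) λ i _ → on i)) (on i₂)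
            where
            on : ∀ i → hyp K A i x
            on i = proj₁ (proj₂ (all≐ _ (i , ≐-refl) x) x∈X)
            p₁≐⋂ : _≐_ K p₁ (⋂ K A (proj₁ (proj₁ p₁∈L₂)))
            p₁≐⋂ = proj₂ (proj₁ p₁∈L₂)

        minRestrictionNumber≡2 : MinRestrictionNumber K A 2
        minRestrictionNumber≡2 = (h , h≉0 , h∉A , restriction-to-h) ,
          λ b b≉0 _ k card → HasCard⇒2≤ card (i₁ , ≐-refl) (restrictions-differ b≉0)

count : ∀ {n} → (Fin n → Bool) → ℕ
count {zero} _ = 0
count {suc n} S = if S zero then suc (count (S ∘ suc)) else count (S ∘ suc)

count≤n : ∀ {n} (S : Fin n → Bool) → count S ℕ.≤ n
count≤n {zero} _ = ℕ.z≤n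
count≤n {suc n} S with S zero
... | true = ℕ.s≤s (count≤n (S ∘ suc))
... | false = ℕ.m≤n⇒m≤1+n (count≤n (S ∘ suc))

count≡n⇒all : ∀ {n} (S : Fin n → Bool) → count S ≡ n → ∀ i → S i ≡ true
count≡n⇒all {suc n} S count≡n i with S zero in S₀ | i
... | true | zero = S₀
... | true | suc j = count≡n⇒all (S ∘ suc) (ℕ.suc-injective count≡n) j
... | false | _ = ⊥-elim (ℕ.1+n≰n (≡.subst (ℕ._≤ n) count≡n (count≤n (S ∘ suc))))

count-∨ : ∀ {n} (S T : Fin n → Bool) → (∀ i → S i ≡ true → T i ≡ true → ⊥) →
  count (λ i → S i ∨ T i) ≡ count S ℕ.+ count T
count-∨ {zero} _ _ _ = ≡.refl
count-∨ {suc n} S T disjoint with S zero in S₀ | T zero in T₀ | count-∨ (S ∘ suc) (T ∘ suc) (disjoint ∘ suc)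
... | true | true | _ = ⊥-elim (disjoint zero S₀ T₀)
... | true | false | ih = ≡.cong suc ih
... | false | true | ih = ≡.trans (≡.cong suc ih) (≡.sym (ℕ.+-suc _ _))
... | false | false | ih = ih

∨≡true⇒ : ∀ x y → x ∨ y ≡ true → x ≡ true ⊎ y ≡ true
∨≡true⇒ true _ _ = inj₁ ≡.refl
∨≡true⇒ false _ y≡true = inj₂ y≡true

module _ {c ℓ : Level} (K : CommutativeRing c ℓ) (A : Arrangement K) where
  open Arrangement A

  sumFin-count : ∀ {n} (S : Fin n → Bool) →
    sumFin K A (λ i → if S i then μ-plane K A else 0ℤ) ≡ ℤ.- (+ count S)
  sumFin-count {zero} S = ≡.refl
  sumFin-count {suc n} S with S zero | sumFin-count (S ∘ suc)
  ... | true | ih = ≡.trans (≡.cong (ℤ._+_ (μ-plane K A)) ih) (≡.sym (ℤ.neg-distrib-+ (+ 1) (+ count (S ∘ suc))))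
  ... | false | ih = ≡.trans (ℤ.+-identityˡ _) ih

  μ≡count-1 : ∀ {X z} → (μX : μ K A X z) → z ≡ + count (proj₁ μX) ℤ.- 1ℤ
  μ≡count-1 (S , _ , ≡.refl) = ≡.trans (≡.cong (λ s → ℤ.- (1ℤ ℤ.+ s)) (sumFin-count S)) (-[1-c]≡c-1 (+ count S))
    where
    -[1-c]≡c-1 : ∀ c → ℤ.- (1ℤ ℤ.+ ℤ.- c) ≡ c ℤ.- 1ℤ
    -[1-c]≡c-1 = solve-∀

  every-plane-contains-p₁-or-p₂ : ∀ {p₁ p₂ z₁ z₂} → μ K A p₁ z₁ → μ K A p₂ z₂ →
    z₁ ℤ.+ z₂ ≡ + size ℤ.- + 2 →
    ¬ (∃ λ i → _⊆_ K p₁ (hyp K A i) × _⊆_ K p₂ (hyp K A i)) →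
    ∀ i → _⊆_ K p₁ (hyp K A i) ⊎ _⊆_ K p₂ (hyp K A i)
  every-plane-contains-p₁-or-p₂ {z₁ = z₁} {z₂ = z₂} μp₁@(S₁ , S₁-spec , _) μp₂@(S₂ , S₂-spec , _)
    sum≡ no-common-plane i =
    Sum.map (proj₁ (S₁-spec i)) (proj₁ (S₂-spec i)) (∨≡true⇒ (S₁ i) (S₂ i) (count≡n⇒all _ count≡size i))
    where
    disjoint : ∀ i → S₁ i ≡ true → S₂ i ≡ true → ⊥
    disjoint i S₁ᵢ S₂ᵢ = no-common-plane (i , proj₁ (S₁-spec i) S₁ᵢ , proj₁ (S₂-spec i) S₂ᵢ)
    counts : count S₁ ℕ.+ count S₂ ≡ size
    counts = ℤ.+-injective (begin
      + count S₁ ℤ.+ + count S₂                                     ≡⟨ shift (+ count S₁) (+ count S₂) ⟩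
      (+ count S₁ ℤ.- 1ℤ) ℤ.+ (+ count S₂ ℤ.- 1ℤ) ℤ.+ + 2           ≡⟨ ≡.cong₂ (λ x y → x ℤ.+ y ℤ.+ + 2)
                                                                         (μ≡count-1 μp₁) (μ≡count-1 μp₂) ⟨
      z₁ ℤ.+ z₂ ℤ.+ + 2                                             ≡⟨ ≡.cong (ℤ._+ + 2) sum≡ ⟩
      + size ℤ.- + 2 ℤ.+ + 2                                        ≡⟨ unshift (+ size) ⟩
      + size                                                        ∎)
      where
      open ≡.≡-Reasoning
      shift : ∀ x y → x ℤ.+ y ≡ (x ℤ.- 1ℤ) ℤ.+ (y ℤ.- 1ℤ) ℤ.+ + 2
      shift = solve-∀
      unshift : ∀ s → s ℤ.- + 2 ℤ.+ + 2 ≡ s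
      unshift = solve-∀
    count≡size : count (λ i → S₁ i ∨ S₂ i) ≡ size
    count≡size = ≡.trans (count-∨ S₁ S₂ disjoint) counts

open import Data.Integer using (ℤ; _+_; _-_; +_)

proposition3p12 : ∀ {c ℓ : Level} (K : CommutativeRing c ℓ) → IsField K → CharZero K →
    (A : Arrangement K) → (p₁ p₂ : Sub K) →
    InL₂ K A p₁ → InL₂ K A p₂ → ¬ (_≐_ K p₁ p₂) →
    (z₁ z₂ : ℤ) → μ K A p₁ z₁ → μ K A p₂ z₂ →
    z₁ + z₂ ≡ (+ Arrangement.size A) - + 2 →
    ¬ (∃ λ i → (_⊆_ K p₁ (hyp K A i)) × (_⊆_ K p₂ (hyp K A i))) →
    MinRestrictionNumber K A 2
proposition3p12 K isField _ A p₁ p₂ p₁∈L₂ p₂∈L₂ p₁≉p₂ z₁ z₂ μp₁ μp₂ sum≡ no-common-plane =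
  minRestrictionNumber≡2 K isField A p₁∈L₂ p₂∈L₂ p₁≉p₂ no-common-plane
    (every-plane-contains-p₁-or-p₂ K A μp₁ μp₂ sum≡ no-common-plane)
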